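{- Let $n\ge 1$ and let $G$ be a (finite, simple) graph on $n$ vertices. Then \[ \partial(G)+\partial(\bar{G})\le 2^{n+1}-2^{\lfloor n/2\rfloor}-2^{\lceil n/2\rceil-1}. \]
   Context: A dominating set in a graph $G$ is a set $S$ of vertices such that every vertex of $G$ is either in $S$ or adjacent to a vertex of $S$. $\partial(G)$ denotes the number of dominating sets of $G$, and $\bar{G}$ denotes the complement of $G$ (same vertex set, two distinct vertices adjacent in $\bar G$ iff they are non-adjacent in $G$). -}

module Defs where

open import Data.Nat using (ℕ; zero; suc)
open import Data.Bool using (Bool; true; false; not; _∧_; _∨_; if_then_else_)
open import Data.Fin using (Fin; zero; suc)
open import Data.Fin.Subset using (Subset)
open import Data.Vec using (Vec; []; _∷_; lookup)
open import Data.List using (List; []; _∷_; map; _++_; length; filter)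
open import Data.Product using (_×_)
open import Relation.Binary.PropositionalEquality using (_≡_; refl; cong; cong₂)
open import Relation.Nullary.Decidable using (Dec)
open import Data.Bool using (T)
open import Data.Bool.Properties using (T?)

record Graph (n : ℕ) : Set where
  field
    adj   : Fin n → Fin n → Bool
    sym   : ∀ u v → adj u v ≡ adj v u
    irrefl : ∀ v → adj v v ≡ false

open Graph public

anyFin : ∀ {n} → (Fin n → Bool) → Bool
anyFin {zero} f = false
anyFin {suc n} f = f zero ∨ anyFin (λ i → f (suc i))

allFin : ∀ {n} → (Fin n → Bool) → Bool
allFin {zero} f = true
allFin {suc n} f = f zero ∧ allFin (λ i → f (suc i))

eqFin : ∀ {n} → Fin n → Fin n → Bool
eqFin zero zero = true
eqFin zero (suc _) = false
eqFin (suc _) zero = false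
eqFin (suc i) (suc j) = eqFin i j

complementAdj : ∀ {n} → Graph n → Fin n → Fin n → Bool
complementAdj G u v = not (eqFin u v) ∧ not (adj G u v)

eqFin-sym : ∀ {n} (u v : Fin n) → eqFin u v ≡ eqFin v u
eqFin-sym zero zero = refl
eqFin-sym zero (suc _) = refl
eqFin-sym (suc _) zero = refl
eqFin-sym (suc i) (suc j) = eqFin-sym i j

eqFin-refl : ∀ {n} (v : Fin n) → eqFin v v ≡ true
eqFin-refl zero = refl
eqFin-refl (suc v) = eqFin-refl v

complement : ∀ {n} → Graph n → Graph n
complement G = record
  { adj = complementAdj G
  ; sym = λ u v → cong₂ (λ x y → not x ∧ not y) (eqFin-sym u v) (Graph.sym G u v)
  ; irrefl = λ v → cong (λ x → not x ∧ not (adj G v v)) (eqFin-refl v)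
  }

isDominatingᵇ : ∀ {n} → (Fin n → Fin n → Bool) → Subset n → Bool
isDominatingᵇ a S =
  allFin (λ v → lookup S v ∨ anyFin (λ u → lookup S u ∧ a v u))

allSubsets : (n : ℕ) → List (Subset n)
allSubsets zero = [] ∷ []
allSubsets (suc n) = map (true ∷_) (allSubsets n) ++ map (false ∷_) (allSubsets n)

numDomAdj : ∀ {n} → (Fin n → Fin n → Bool) → ℕ
numDomAdj {n} a = length (filter (λ S → T? (isDominatingᵇ a S)) (allSubsets n))

∂ : ∀ {n} → Graph n → ℕ
∂ G = numDomAdj (adj G)

-- Fix a vertex v. A set S of vertices all of which are non-neighbours of v
-- (v itself excluded) leaves v undominated, so if v has d non-neighbours in G
-- then ∂(G) ≤ 2^n − 2^d. In Ḡ the non-neighbours of v are its neighbours in G,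
-- so ∂(G) + ∂(Ḡ) ≤ 2^(n+1) − 2^d − 2^(n−1−d), and 2^d + 2^(n−1−d) is smallest
-- when d and n−1−d are as balanced as possible.
module Submission where

open import Defs hiding (sym)
open import Data.Nat using (ℕ; zero; suc; _+_; _*_; _∸_; _^_; _≤_; s≤s; ⌊_/2⌋; ⌈_/2⌉)
open import Data.Nat.Properties
open import Data.Bool using (Bool; true; false; not; _∧_; _∨_; T)
open import Data.Bool.Properties using (T?; ∧-zeroʳ; ¬-not)
open import Data.Fin using (Fin; zero; suc)
open import Data.Fin.Subset using (Subset; inside; outside; _∈_; _∉_; _⊆_; ∁; ∣_∣)
open import Data.Fin.Subset.Properties using (_⊆?_; drop-∷-⊆; in⊆in; out⊆; x∈∁p⇒x∉p; ∣∁p∣≡n∸∣p∣; ∣p∣≤n)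
open import Data.Vec using ([]; _∷_; lookup; tabulate; here; there)
open import Data.Vec.Properties using (lookup⇒[]=; []=⇒lookup; lookup∘tabulate)
open import Data.List using (List; []; _∷_; map; _++_; length; filter)
open import Data.List.Properties using (length-map; length-++; filter-++; filter-≐; filter-none)
open import Data.List.Relation.Unary.All using (universal)
open import Data.List.Relation.Binary.Sublist.Propositional using (⊆-refl)
import Data.List.Relation.Binary.Sublist.Propositional.Properties as Sublist
open import Data.Product using (_,_)
open import Function using (_∘_; case_of_)
open import Level using (Level)
open import Relation.Nullary using (does; ¬_)
open import Relation.Unary.Properties using (∁?)
open import Relation.Unary using (Pred; Decidable) renaming (_⊆_ to _⇒_)
open import Relation.Binary.PropositionalEquality
open import Algebra.Properties.CommutativeSemigroup +-commutativeSemigroup using () renaming (interchange to +-interchange)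

private
  variable
    ℓ : Level
    X : Set

2^n+2^n≡2^[1+n] : ∀ n → 2 ^ n + 2 ^ n ≡ 2 ^ suc n
2^n+2^n≡2^[1+n] n = cong (2 ^ n +_) (sym (+-identityʳ (2 ^ n)))

module _ {P : Pred X ℓ} (P? : Decidable P) where

  length-filter+length-filter-∁ : ∀ xs →
    length (filter P? xs) + length (filter (∁? P?) xs) ≡ length xs
  length-filter+length-filter-∁ [] = refl
  length-filter+length-filter-∁ (x ∷ xs) with does (P? x)
  ... | true  = cong suc (length-filter+length-filter-∁ xs)
  ... | false = trans (+-suc _ _) (cong suc (length-filter+length-filter-∁ xs))

  length-filter-mono : ∀ {Q : Pred X ℓ} (Q? : Decidable Q) → P ⇒ Q → ∀ xs →
    length (filter P? xs) ≤ length (filter Q? xs)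
  length-filter-mono Q? P⇒Q xs =
    Sublist.length-mono-≤ (Sublist.filter⁺ P? Q? (λ { refl → P⇒Q }) (⊆-refl {x = xs}))

length-allSubsets : ∀ n → length (allSubsets n) ≡ 2 ^ n
length-allSubsets zero = refl
length-allSubsets (suc n) = begin
    length (map (inside ∷_) Ss ++ map (outside ∷_) Ss)
  ≡⟨ length-++ (map (inside ∷_) Ss) ⟩
    length (map (inside ∷_) Ss) + length (map (outside ∷_) Ss)
  ≡⟨ cong₂ _+_ (length-map (inside ∷_) Ss) (length-map (outside ∷_) Ss) ⟩
    length Ss + length Ss
  ≡⟨ cong₂ _+_ (length-allSubsets n) (length-allSubsets n) ⟩
    2 ^ n + 2 ^ n
  ≡⟨ 2^n+2^n≡2^[1+n] n ⟩
    2 ^ suc n ∎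
  where
  open ≡-Reasoning
  Ss : List (Subset n)
  Ss = allSubsets n

length-filter-allSubsets-suc : ∀ {n} {P : Pred (Subset (suc n)) ℓ} (P? : Decidable P) →
  length (filter P? (allSubsets (suc n))) ≡
  length (filter (P? ∘ (inside ∷_)) (allSubsets n)) + length (filter (P? ∘ (outside ∷_)) (allSubsets n))
length-filter-allSubsets-suc {n = n} P? = begin
    length (filter P? (map (inside ∷_) Ss ++ map (outside ∷_) Ss))
  ≡⟨ cong length (filter-++ P? (map (inside ∷_) Ss) (map (outside ∷_) Ss)) ⟩
    length (filter P? (map (inside ∷_) Ss) ++ filter P? (map (outside ∷_) Ss))
  ≡⟨ length-++ (filter P? (map (inside ∷_) Ss)) ⟩
    length (filter P? (map (inside ∷_) Ss)) + length (filter P? (map (outside ∷_) Ss))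
  ≡⟨ cong₂ _+_ (length-filter-map (inside ∷_) Ss) (length-filter-map (outside ∷_) Ss) ⟩
    length (filter (P? ∘ (inside ∷_)) Ss) + length (filter (P? ∘ (outside ∷_)) Ss) ∎
  where
  open ≡-Reasoning
  Ss : List (Subset n)
  Ss = allSubsets n
  length-filter-map : ∀ f (xs : List (Subset n)) →
    length (filter P? (map f xs)) ≡ length (filter (P? ∘ f) xs)
  length-filter-map f [] = refl
  length-filter-map f (x ∷ xs) with does (P? (f x))
  ... | true  = cong suc (length-filter-map f xs)
  ... | false = length-filter-map f xs

length-filter-⊆-allSubsets : ∀ {n} (q : Subset n) →
  length (filter (_⊆? q) (allSubsets n)) ≡ 2 ^ ∣ q ∣
length-filter-⊆-allSubsets [] = refl
length-filter-⊆-allSubsets {suc n} (inside ∷ q) = begin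
    length (filter (_⊆? inside ∷ q) (allSubsets (suc n)))
  ≡⟨ length-filter-allSubsets-suc (_⊆? inside ∷ q) ⟩
    length (filter (λ S → inside ∷ S ⊆? inside ∷ q) Ss)
      + length (filter (λ S → outside ∷ S ⊆? inside ∷ q) Ss)
  ≡⟨ cong₂ _+_ (cong length (filter-≐ _ (_⊆? q) (drop-∷-⊆ , in⊆in) Ss))
               (cong length (filter-≐ _ (_⊆? q) (drop-∷-⊆ , out⊆) Ss)) ⟩
    length (filter (_⊆? q) Ss) + length (filter (_⊆? q) Ss)
  ≡⟨ cong₂ _+_ (length-filter-⊆-allSubsets q) (length-filter-⊆-allSubsets q) ⟩
    2 ^ ∣ q ∣ + 2 ^ ∣ q ∣
  ≡⟨ 2^n+2^n≡2^[1+n] ∣ q ∣ ⟩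
    2 ^ suc ∣ q ∣ ∎
  where
  open ≡-Reasoning
  Ss : List (Subset n)
  Ss = allSubsets n
length-filter-⊆-allSubsets {suc n} (outside ∷ q) = begin
    length (filter (_⊆? outside ∷ q) (allSubsets (suc n)))
  ≡⟨ length-filter-allSubsets-suc (_⊆? outside ∷ q) ⟩
    length (filter (λ S → inside ∷ S ⊆? outside ∷ q) Ss)
      + length (filter (λ S → outside ∷ S ⊆? outside ∷ q) Ss)
  ≡⟨ cong₂ _+_ (cong length (filter-none _ (universal (λ _ S⊆q → case S⊆q here of λ ()) Ss)))
               (cong length (filter-≐ _ (_⊆? q) (drop-∷-⊆ , out⊆) Ss)) ⟩
    length (filter (_⊆? q) Ss)
  ≡⟨ length-filter-⊆-allSubsets q ⟩
    2 ^ ∣ q ∣ ∎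
  where
  open ≡-Reasoning
  Ss : List (Subset n)
  Ss = allSubsets n

anyFin≡false : ∀ {n} (f : Fin n → Bool) → (∀ i → f i ≡ false) → anyFin f ≡ false
anyFin≡false {zero} f f≡false = refl
anyFin≡false {suc n} f f≡false rewrite f≡false zero = anyFin≡false (f ∘ suc) (f≡false ∘ suc)

allFin≡false : ∀ {n} (f : Fin n → Bool) i → f i ≡ false → allFin f ≡ false
allFin≡false f zero    fi≡false rewrite fi≡false = refl
allFin≡false f (suc i) fi≡false =
  trans (cong (f zero ∧_) (allFin≡false (f ∘ suc) i fi≡false)) (∧-zeroʳ (f zero))

∉⇒lookup≡outside : ∀ {n} {p : Subset n} {x} → x ∉ p → lookup p x ≡ outside
∉⇒lookup≡outside {p = p} {x} x∉p = ¬-not (x∉p ∘ lookup⇒[]= x p)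

module _ {n} (a : Fin n → Fin n → Bool) {v : Fin n} {q : Subset n}
         (v∉q : v ∉ q) (q-nonadjacent : ∀ {u} → u ∈ q → a v u ≡ false) where

  ⊆nonNeighbours⇒notDominating : ∀ {S} → S ⊆ q → isDominatingᵇ a S ≡ false
  ⊆nonNeighbours⇒notDominating {S} S⊆q =
    allFin≡false _ v (cong₂ _∨_ (∉⇒lookup≡outside (v∉q ∘ S⊆q)) (anyFin≡false _ no-dominator))
    where
    no-dominator : ∀ u → lookup S u ∧ a v u ≡ false
    no-dominator u with lookup S u in u∈S
    ... | true  = q-nonadjacent (S⊆q (lookup⇒[]= u S u∈S))
    ... | false = refl

  numDomAdj+2^∣nonNeighbours∣≤2^n : numDomAdj a + 2 ^ ∣ q ∣ ≤ 2 ^ n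
  numDomAdj+2^∣nonNeighbours∣≤2^n = begin
      length (filter Dom? Ss) + 2 ^ ∣ q ∣
    ≡⟨ cong (length (filter Dom? Ss) +_) (sym (length-filter-⊆-allSubsets q)) ⟩
      length (filter Dom? Ss) + length (filter (_⊆? q) Ss)
    ≤⟨ +-monoʳ-≤ _ (length-filter-mono (_⊆? q) (∁? Dom?) notDominating Ss) ⟩
      length (filter Dom? Ss) + length (filter (∁? Dom?) Ss)
    ≡⟨ length-filter+length-filter-∁ Dom? Ss ⟩
      length Ss
    ≡⟨ length-allSubsets n ⟩
      2 ^ n ∎
    where
    open ≤-Reasoning
    Ss : List (Subset n)
    Ss = allSubsets n
    Dom? : Decidable (λ S → T (isDominatingᵇ a S))
    Dom? S = T? (isDominatingᵇ a S)
    notDominating : ∀ {S} → S ⊆ q → ¬ T (isDominatingᵇ a S)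
    notDominating S⊆q = subst T (⊆nonNeighbours⇒notDominating S⊆q)

x+y≤1+x*y : ∀ {x y} → 1 ≤ x → 1 ≤ y → x + y ≤ 1 + x * y
x+y≤1+x*y {suc x} {suc y} _ _ = begin
    suc x + suc y   ≡⟨ +-comm (suc x) (suc y) ⟩
    suc (y + suc x) ≡⟨ cong suc (+-suc y x) ⟩
    suc (suc y + x) ≤⟨ s≤s (+-monoʳ-≤ (suc y) (m≤m*n x (suc y))) ⟩
    1 + suc x * suc y ∎
  where open ≤-Reasoning

2^⌈n/2⌉+2^⌊n/2⌋≤1+2^n : ∀ n → 2 ^ ⌈ n /2⌉ + 2 ^ ⌊ n /2⌋ ≤ 1 + 2 ^ n
2^⌈n/2⌉+2^⌊n/2⌋≤1+2^n n = begin
    2 ^ ⌈ n /2⌉ + 2 ^ ⌊ n /2⌋   ≤⟨ x+y≤1+x*y (m^n>0 2 ⌈ n /2⌉) (m^n>0 2 ⌊ n /2⌋) ⟩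
    1 + 2 ^ ⌈ n /2⌉ * 2 ^ ⌊ n /2⌋ ≡⟨ cong suc (^-distribˡ-+-* 2 ⌈ n /2⌉ ⌊ n /2⌋) ⟨
    1 + 2 ^ (⌈ n /2⌉ + ⌊ n /2⌋) ≡⟨ cong (λ k → 1 + 2 ^ k) (trans (+-comm ⌈ n /2⌉ ⌊ n /2⌋) (⌊n/2⌋+⌈n/2⌉≡n n)) ⟩
    1 + 2 ^ n ∎
  where open ≤-Reasoning

2^⌈[a+b]/2⌉+2^⌊[a+b]/2⌋≤2^a+2^b : ∀ a b →
  2 ^ ⌈ (a + b) /2⌉ + 2 ^ ⌊ (a + b) /2⌋ ≤ 2 ^ a + 2 ^ b
2^⌈[a+b]/2⌉+2^⌊[a+b]/2⌋≤2^a+2^b zero b = 2^⌈n/2⌉+2^⌊n/2⌋≤1+2^n b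
2^⌈[a+b]/2⌉+2^⌊[a+b]/2⌋≤2^a+2^b (suc a) zero
  rewrite +-identityʳ a | +-comm (2 ^ suc a) 1 = 2^⌈n/2⌉+2^⌊n/2⌋≤1+2^n (suc a)
2^⌈[a+b]/2⌉+2^⌊[a+b]/2⌋≤2^a+2^b (suc a) (suc b) rewrite +-suc a b =
  subst₂ _≤_ (*-distribˡ-+ 2 (2 ^ ⌈ (a + b) /2⌉) _) (*-distribˡ-+ 2 (2 ^ a) (2 ^ b))
    (*-monoʳ-≤ 2 (2^⌈[a+b]/2⌉+2^⌊[a+b]/2⌋≤2^a+2^b a b))

∣∁p∣+∣p∣≡n : ∀ {n} (p : Subset n) → ∣ ∁ p ∣ + ∣ p ∣ ≡ n
∣∁p∣+∣p∣≡n p = trans (cong (_+ ∣ p ∣) (∣∁p∣≡n∸∣p∣ p)) (m∸n+n≡m (∣p∣≤n p))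

∈tabulate⇒≡true : ∀ {n} {f : Fin n → Bool} {i} → i ∈ tabulate f → f i ≡ true
∈tabulate⇒≡true {f = f} {i} i∈ = trans (sym (lookup∘tabulate f i)) ([]=⇒lookup i∈)

∉tabulate⇒≡false : ∀ {n} {f : Fin n → Bool} {i} → i ∉ tabulate f → f i ≡ false
∉tabulate⇒≡false {f = f} {i} i∉ = trans (sym (lookup∘tabulate f i)) (∉⇒lookup≡outside i∉)

theorem1 : (n : ℕ) → 1 ≤ n → (G : Graph n) →
    ∂ G + ∂ (complement G) + 2 ^ ⌊ n /2⌋ + 2 ^ (⌈ n /2⌉ ∸ 1) ≤ 2 ^ (n + 1)
-- For n = suc m, ⌊ n /2⌋ and ⌈ n /2⌉ ∸ 1 reduce to ⌈ m /2⌉ and ⌊ m /2⌋.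
theorem1 (suc m) _ G = begin
    ∂ G + ∂ (complement G) + 2 ^ ⌈ m /2⌉ + 2 ^ ⌊ m /2⌋
  ≡⟨ +-assoc (∂ G + ∂ (complement G)) _ _ ⟩
    ∂ G + ∂ (complement G) + (2 ^ ⌈ m /2⌉ + 2 ^ ⌊ m /2⌋)
  ≤⟨ +-monoʳ-≤ (∂ G + ∂ (complement G)) balanced ⟩
    ∂ G + ∂ (complement G) + (2 ^ ∣ ∁ N ∣ + 2 ^ ∣ N ∣)
  ≡⟨ +-interchange (∂ G) (∂ (complement G)) _ _ ⟩
    (∂ G + 2 ^ ∣ ∁ N ∣) + (∂ (complement G) + 2 ^ ∣ N ∣)
  ≤⟨ +-mono-≤ (numDomAdj+2^∣nonNeighbours∣≤2^n (adj G) (λ ()) G-nonadjacent)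
              (numDomAdj+2^∣nonNeighbours∣≤2^n (complementAdj G) (λ ()) Ḡ-nonadjacent) ⟩
    2 ^ suc m + 2 ^ suc m
  ≡⟨ 2^n+2^n≡2^[1+n] (suc m) ⟩
    2 ^ (1 + suc m)
  ≡⟨ cong (2 ^_) (+-comm 1 (suc m)) ⟩
    2 ^ (suc m + 1) ∎
  where
  open ≤-Reasoning
  N : Subset m
  N = tabulate (adj G zero ∘ suc)
  balanced : 2 ^ ⌈ m /2⌉ + 2 ^ ⌊ m /2⌋ ≤ 2 ^ ∣ ∁ N ∣ + 2 ^ ∣ N ∣
  balanced = subst (λ k → 2 ^ ⌈ k /2⌉ + 2 ^ ⌊ k /2⌋ ≤ 2 ^ ∣ ∁ N ∣ + 2 ^ ∣ N ∣)
    (∣∁p∣+∣p∣≡n N) (2^⌈[a+b]/2⌉+2^⌊[a+b]/2⌋≤2^a+2^b ∣ ∁ N ∣ ∣ N ∣)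
  G-nonadjacent : ∀ {u} → u ∈ outside ∷ ∁ N → adj G zero u ≡ false
  G-nonadjacent (there i∈∁N) = ∉tabulate⇒≡false (x∈∁p⇒x∉p i∈∁N)
  Ḡ-nonadjacent : ∀ {u} → u ∈ outside ∷ N → complementAdj G zero u ≡ false
  -- complementAdj G zero (suc i) reduces to not (adj G zero (suc i)).
  Ḡ-nonadjacent (there i∈N) = cong not (∈tabulate⇒≡true i∈N)
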